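{- For all integers $L$ and $j$, \[ \sum_{\substack{r=0\\ r\equiv j \ (\mathrm{mod}\ 2)}}^{L} q^{\frac12 r^2}\,(-q;q)_{L-r}\begin{bmatrix}L\\ r\end{bmatrix}_{q^2}\begin{bmatrix} r\\ \frac12(r-j)\end{bmatrix}_{q^2} = q^{\frac12 j^2}\begin{bmatrix}2L\\ L-j\end{bmatrix}_{q}. \]
   Context: For $n\ge 0$, $(a;q)_n=\prod_{i=0}^{n-1}(1-aq^i)$. The $q$-binomial coefficient is $\begin{bmatrix}L\\ a\end{bmatrix}_q=\frac{(q;q)_L}{(q;q)_a(q;q)_{L-a}}$ if $a\in\{0,1,\dots,L\}$ and $0$ otherwise (in particular it is $0$ if $L<0$ or $a$ is not an integer in that range). When the base is not indicated it is $q$. Identities are identities of polynomials/rational functions in $q$ (fractional powers of $q$ allowed). -}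

module Defs where

open import Level using (Level)
open import Data.Nat as ℕ using (ℕ; zero; suc; _∸_)
open import Data.Integer as ℤ using (ℤ; +_; -[1+_]; ∣_∣)
import Data.Integer.DivMod as ℤDM
open import Relation.Nullary using (yes; no)
open import Algebra.Bundles using (CommutativeRing)

module QSeries {c ℓ : Level} (R : CommutativeRing c ℓ) where
  open CommutativeRing R hiding (zero)

  pow : Carrier → ℕ → Carrier
  pow x zero = 1#
  pow x (suc n) = x * pow x n

  poch : Carrier → Carrier → ℕ → Carrier
  poch a q zero = 1#
  poch a q (suc n) = poch a q n * (1# - a * pow q n)

  qbinℕ : Carrier → ℕ → ℕ → Carrier
  qbinℕ q L zero = 1#
  qbinℕ q zero (suc a) = 0#
  qbinℕ q (suc L) (suc a) = qbinℕ q L a + pow q (suc a) * qbinℕ q L (suc a)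

  qbin : Carrier → ℤ → ℤ → Carrier
  qbin q (+ L) (+ a) = qbinℕ q L a
  qbin q (+ L) -[1+ a ] = 0#
  qbin q -[1+ L ] a = 0#

  sumTo : (ℕ → Carrier) → ℕ → Carrier
  sumTo f zero = f zero
  sumTo f (suc n) = sumTo f n + f (suc n)

  sumUpTo : (ℕ → Carrier) → ℤ → Carrier
  sumUpTo f (+ n) = sumTo f n
  sumUpTo f -[1+ n ] = 0#

  ifSameParity : ℕ → ℤ → Carrier → Carrier
  ifSameParity r j x with ℕ._≟_ (ℕ._%_ ∣ (+ r) ℤ.- j ∣ 2) 0
  ... | yes _ = x
  ... | no _  = 0#

  -- Throughout, t stands for q^(1/2), so q = t^2, q^2 = t^4, q^(k/2) = t^k.
  -- Left-hand side of the identity: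
  -- Σ_{r=0, r≡j (2)}^{L} q^{r²/2} (-q;q)_{L-r} [L,r]_{q²} [r,(r-j)/2]_{q²}
  lhs : Carrier → ℤ → ℤ → Carrier
  lhs t L j = sumUpTo term L
    where
      q = pow t 2
      term : ℕ → Carrier
      term r = ifSameParity r j
        (pow t (r ℕ.* r)
         * poch (- q) q (∣ L ∣ ∸ r)
         * qbin (pow q 2) L (+ r)
         * qbin (pow q 2) (+ r) (((+ r) ℤ.- j) ℤDM./ (+ 2)))

  rhs : Carrier → ℤ → ℤ → Carrier
  rhs t L j = pow t (∣ j ∣ ℕ.* ∣ j ∣) * qbin (pow t 2) ((+ 2) ℤ.* L) (L ℤ.- j)

{-# OPTIONS --safe #-}
-- For L = n ≥ 0 both sides, as functions X n j, satisfy
--   X (n+1) j = (1 + q^(2n+1)) X n j + q^(n+1/2) (X n (j−1) + X n (j+1))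
-- and they agree at n = 0, so they agree everywhere (for L < 0 both vanish).  For the right
-- side this is the three-term Pascal recurrence
--   [2n+2, k+1] = (1 + q^(2n+1)) [2n, k] + q^(k+1) [2n, k+1] + q^(2n+1−k) [2n, k−1].
-- For the left side, write the summand as c(n,r) H(r,j) with c(n,r) = q^(r²/2) (−q;q)_(n−r) [n,r]_(q²)
-- and H(r,j) = [r, (r−j)/2]_(q²) (zero unless r ≡ j mod 2).  Then
--   c(n+1,r) = (1 + q^(2n+1)) c(n,r) + q^(n+1/2) (c(n,r−1) + (1 − q^(2r+2)) c(n,r+1)),
--   H(r+1,j) + (1 − q^(2r)) H(r−1,j) = H(r,j−1) + H(r,j+1),
-- and shifting the summation index turns the first into the recurrence via the second.  Both follow
-- from the q-Pascal rules and the absorption identity (1 − x^(k+1)) [n,k+1]_x = (1 − x^(n−k)) [n,k]_x.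
-- Everything is proved in an arbitrary commutative ring, with t in the role of q^(1/2).
module Submission where

open import Defs
open import Level using (Level)
open import Data.Integer using (ℤ)
open import Algebra.Bundles using (CommutativeRing)
open import Algebra.Solver.Ring.AlmostCommutativeRing using (fromCommutativeRing; _-Raw-AlmostCommutative⟶_)
open import Data.Empty using (⊥-elim)
open import Data.Integer.Base as ℤ using (+_; -[1+_]; ∣_∣; _⊖_)
import Data.Integer.Properties as ℤₚ
import Data.Integer.Tactic.RingSolver as ℤ-Solver
open import Data.Maybe using (Maybe; just; nothing)
open import Data.Nat.Base as ℕ using (ℕ; zero; suc; _∸_; _<_; s≤s; z≤n)
import Data.Nat.DivMod as ℕDM
import Data.Nat.Properties as ℕₚ
open import Data.Nat.Tactic.RingSolver using (solve-∀)
open import Data.Sign as Sign using (Sign)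
open import Relation.Binary.PropositionalEquality as ≡ using (_≡_; _≢_)
open import Relation.Nullary using (yes; no)

-- The ring solver decides equalities by evaluating normal forms, so its coefficients are integers
-- mapped into the ring.  With the type-checking-optimised _×_, fromℤ (+ 1) reduces to 1#, so the
-- constants of a solved equation agree definitionally with those of the goal.
module IntegerCoefficientSolver {c ℓ : Level} (R : CommutativeRing c ℓ) where
  open CommutativeRing R
  open import Algebra.Properties.Ring ring
    using (-0#≈0#; -‿involutive; -‿anti-homo-+; -‿distribˡ-*; -‿distribʳ-*; xyx⁻¹≈y)
  open import Algebra.Properties.Semiring.Mult.TCOptimised semiring using (_×_; ×-homo-+; ×1-homo-*)
  open import Algebra.Properties.CommutativeSemigroup *-commutativeSemigroup using (x∙yz≈y∙xz)
  open import Relation.Binary.Reasoning.Setoid setoid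

  fromℤ : ℤ → Carrier
  fromℤ (+ n)    = n × 1#
  fromℤ -[1+ n ] = - (suc n × 1#)

  private
    x≈x-0 : ∀ x → x ≈ x - 0#
    x≈x-0 x = sym (trans (+-congˡ -0#≈0#) (+-identityʳ x))

  fromℤ-⊖ : ∀ m n → fromℤ (m ⊖ n) ≈ m × 1# - n × 1#
  fromℤ-⊖ zero    zero    = x≈x-0 0#
  fromℤ-⊖ zero    (suc n) = sym (+-identityˡ _)
  fromℤ-⊖ (suc m) zero    = x≈x-0 _
  fromℤ-⊖ (suc m) (suc n) = begin
    fromℤ (suc m ⊖ suc n)        ≡⟨ ≡.cong fromℤ (ℤₚ.[1+m]⊖[1+n]≡m⊖n m n) ⟩
    fromℤ (m ⊖ n)                ≈⟨ fromℤ-⊖ m n ⟩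
    a - b                        ≈⟨ xyx⁻¹≈y 1# (a - b) ⟨
    1# + (a - b) - 1#            ≈⟨ trans (+-congʳ (sym (+-assoc 1# a (- b)))) (+-assoc _ _ _) ⟩
    (1# + a) + (- b - 1#)        ≈⟨ +-congˡ (-‿anti-homo-+ 1# b) ⟨
    (1# + a) - (1# + b)          ≈⟨ +-cong (×-homo-+ 1# 1 m) (-‿cong (×-homo-+ 1# 1 n)) ⟨
    suc m × 1# - suc n × 1#      ∎
    where a = m × 1#; b = n × 1#

  fromℤ-+ : ∀ i j → fromℤ (i ℤ.+ j) ≈ fromℤ i + fromℤ j
  fromℤ-+ (+ m)    (+ n)    = ×-homo-+ 1# m n
  fromℤ-+ (+ m)    -[1+ n ] = fromℤ-⊖ m (suc n)
  fromℤ-+ -[1+ m ] (+ n)    = trans (fromℤ-⊖ n (suc m)) (+-comm _ _)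
  fromℤ-+ -[1+ m ] -[1+ n ] = begin
    - (suc (suc m ℕ.+ n) × 1#)            ≡⟨ ≡.cong (λ k → - (k × 1#)) (≡.sym (ℕₚ.+-suc (suc m) n)) ⟩
    - ((suc m ℕ.+ suc n) × 1#)            ≈⟨ -‿cong (×-homo-+ 1# (suc m) (suc n)) ⟩
    - (suc m × 1# + suc n × 1#)           ≈⟨ -‿anti-homo-+ _ _ ⟩
    - (suc n × 1#) - (suc m × 1#)         ≈⟨ +-comm _ _ ⟩
    - (suc m × 1#) - (suc n × 1#)         ∎

  signOf : Sign → Carrier
  signOf Sign.+ = 1#
  signOf Sign.- = - 1#

  fromℤ-◃ : ∀ s n → fromℤ (s ℤ.◃ n) ≈ signOf s * (n × 1#)
  fromℤ-◃ s       zero    = sym (zeroʳ _)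
  fromℤ-◃ Sign.+  (suc n) = sym (*-identityˡ _)
  fromℤ-◃ Sign.-  (suc n) = trans (-‿cong (sym (*-identityˡ _))) (-‿distribˡ-* _ _)

  fromℤ-sign : ∀ i → fromℤ i ≈ signOf (ℤ.sign i) * (∣ i ∣ × 1#)
  fromℤ-sign i = trans (reflexive (≡.cong fromℤ (≡.sym (ℤₚ.◃-inverse i)))) (fromℤ-◃ (ℤ.sign i) ∣ i ∣)

  signOf-* : ∀ s s′ → signOf (s Sign.* s′) ≈ signOf s * signOf s′
  signOf-* Sign.+ s′     = sym (*-identityˡ _)
  signOf-* Sign.- Sign.+ = sym (*-identityʳ _)
  signOf-* Sign.- Sign.- = begin
    1#            ≈⟨ -‿involutive 1# ⟨
    - - 1#        ≈⟨ -‿cong (*-identityʳ (- 1#)) ⟨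
    - (- 1# * 1#) ≈⟨ -‿distribʳ-* (- 1#) 1# ⟩
    - 1# * - 1#   ∎

  fromℤ-* : ∀ i j → fromℤ (i ℤ.* j) ≈ fromℤ i * fromℤ j
  fromℤ-* i j = begin
    fromℤ (s i Sign.* s j ℤ.◃ ∣ i ∣ ℕ.* ∣ j ∣)
      ≈⟨ fromℤ-◃ (s i Sign.* s j) (∣ i ∣ ℕ.* ∣ j ∣) ⟩
    signOf (s i Sign.* s j) * ((∣ i ∣ ℕ.* ∣ j ∣) × 1#)
      ≈⟨ *-cong (signOf-* (s i) (s j)) (×1-homo-* ∣ i ∣ ∣ j ∣) ⟩
    (signOf (s i) * signOf (s j)) * ((∣ i ∣ × 1#) * (∣ j ∣ × 1#))
      ≈⟨ interchange _ _ _ _ ⟩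
    (signOf (s i) * (∣ i ∣ × 1#)) * (signOf (s j) * (∣ j ∣ × 1#))
      ≈⟨ *-cong (fromℤ-sign i) (fromℤ-sign j) ⟨
    fromℤ i * fromℤ j                              ∎
    where
    s = ℤ.sign
    interchange : ∀ a b x y → (a * b) * (x * y) ≈ (a * x) * (b * y)
    interchange a b x y = begin
      (a * b) * (x * y) ≈⟨ *-assoc a b (x * y) ⟩
      a * (b * (x * y)) ≈⟨ *-congˡ (x∙yz≈y∙xz b x y) ⟩
      a * (x * (b * y)) ≈⟨ *-assoc a x (b * y) ⟨
      (a * x) * (b * y) ∎

  fromℤ-- : ∀ i → fromℤ (ℤ.- i) ≈ - fromℤ i
  fromℤ-- (+ zero)  = sym -0#≈0#
  fromℤ-- (+ suc n) = refl
  fromℤ-- -[1+ n ]  = sym (-‿involutive _)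

  fromℤ-homomorphism : ℤ.+-*-rawRing -Raw-AlmostCommutative⟶ fromCommutativeRing R
  fromℤ-homomorphism = record
    { ⟦_⟧ = fromℤ ; +-homo = fromℤ-+ ; *-homo = fromℤ-* ; -‿homo = fromℤ--
    ; 0-homo = refl ; 1-homo = refl }

  fromℤ-≟ : ∀ i j → Maybe (fromℤ i ≈ fromℤ j)
  fromℤ-≟ i j with i ℤₚ.≟ j
  ... | yes ≡.refl = just refl
  ... | no _       = nothing

  open import Algebra.Solver.Ring ℤ.+-*-rawRing (fromCommutativeRing R) fromℤ-homomorphism fromℤ-≟ public

data Position : ℕ → ℕ → Set where
  inside    : ∀ k b → Position (k ℕ.+ b) k
  justAbove : ∀ n → Position n (suc n)
  farAbove  : ∀ n u → Position n (suc (suc (n ℕ.+ u)))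

position : ∀ n k → Position n k
position n       zero          = inside 0 n
position zero    (suc zero)    = justAbove 0
position zero    (suc (suc k)) = farAbove 0 k
position (suc n) (suc k) with position n k
... | inside k b   = inside (suc k) b
... | justAbove n  = justAbove (suc n)
... | farAbove n u = farAbove (suc n) u

-- ℤ.suc and ℤ.pred are spelled out below because the reflective solver does not unfold them.
suc[i]-j≡suc[i-j] : ∀ i j → ℤ.suc i ℤ.- j ≡ ℤ.suc (i ℤ.- j)
suc[i]-j≡suc[i-j] = unfolded
  where unfolded : ∀ i j → (+ 1 ℤ.+ i) ℤ.- j ≡ + 1 ℤ.+ (i ℤ.- j)
        unfolded = ℤ-Solver.solve-∀

i-pred[j]≡suc[i-j] : ∀ i j → i ℤ.- ℤ.pred j ≡ ℤ.suc (i ℤ.- j)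
i-pred[j]≡suc[i-j] = unfolded
  where unfolded : ∀ i j → i ℤ.- (ℤ.- + 1 ℤ.+ j) ≡ + 1 ℤ.+ (i ℤ.- j)
        unfolded = ℤ-Solver.solve-∀

i-suc[j]≡pred[i-j] : ∀ i j → i ℤ.- ℤ.suc j ≡ ℤ.pred (i ℤ.- j)
i-suc[j]≡pred[i-j] = unfolded
  where unfolded : ∀ i j → i ℤ.- (+ 1 ℤ.+ j) ≡ ℤ.- + 1 ℤ.+ (i ℤ.- j)
        unfolded = ℤ-Solver.solve-∀

square : ℤ → ℕ
square i = ∣ i ∣ ℕ.* ∣ i ∣

+∣i∣²≡i*i : ∀ i → + square i ≡ i ℤ.* i
+∣i∣²≡i*i (+ n)    = ≡.sym (ℤₚ.+◃n≡+n (n ℕ.* n))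
+∣i∣²≡i*i -[1+ n ] = ≡.refl

module Properties {c ℓ : Level} (R : CommutativeRing c ℓ) where
  open CommutativeRing R hiding (zero)
  open QSeries R
  open IntegerCoefficientSolver R
  open import Algebra.Properties.Semiring.Exp semiring using (_^_; ^-homo-*; ^-assocʳ)
  open import Relation.Binary.Reasoning.Setoid setoid

  0ₚ 1ₚ : ∀ {n} → Polynomial n
  0ₚ = con (+ 0)
  1ₚ = con (+ 1)

  pow≡^ : ∀ x n → pow x n ≡ x ^ n
  pow≡^ x zero    = ≡.refl
  pow≡^ x (suc n) = ≡.cong (x *_) (pow≡^ x n)

  pow-+ : ∀ x m n → pow x (m ℕ.+ n) ≈ pow x m * pow x n
  pow-+ x m n rewrite pow≡^ x (m ℕ.+ n) | pow≡^ x m | pow≡^ x n = ^-homo-* x m n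

  pow-* : ∀ x m n → pow (pow x m) n ≈ pow x (m ℕ.* n)
  pow-* x m n rewrite pow≡^ (pow x m) n | pow≡^ x m | pow≡^ x (m ℕ.* n) = ^-assocʳ x m n

  pow-cong : ∀ x {m n} → m ≡ n → pow x m ≈ pow x n
  pow-cong x m≡n = reflexive (≡.cong (pow x) m≡n)

  pow-square : ∀ x n → pow (pow x 2) n ≈ pow x n * pow x n
  pow-square x n = begin
    pow (pow x 2) n      ≈⟨ pow-* x 2 n ⟩
    pow x (2 ℕ.* n)      ≈⟨ pow-cong x (≡.cong (n ℕ.+_) (ℕₚ.+-identityʳ n)) ⟩
    pow x (n ℕ.+ n)      ≈⟨ pow-+ x n n ⟩
    pow x n * pow x n    ∎

  x^a*x^b≈x^c*[x²]^d : ∀ x a b c d → a ℕ.+ b ≡ c ℕ.+ (d ℕ.+ d) →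
                       pow x a * pow x b ≈ pow x c * pow (pow x 2) d
  x^a*x^b≈x^c*[x²]^d x a b c d eq = begin
    pow x a * pow x b                  ≈⟨ pow-+ x a b ⟨
    pow x (a ℕ.+ b)                    ≈⟨ pow-cong x eq ⟩
    pow x (c ℕ.+ (d ℕ.+ d))            ≈⟨ pow-+ x c (d ℕ.+ d) ⟩
    pow x c * pow x (d ℕ.+ d)          ≈⟨ *-congˡ (pow-+ x d d) ⟩
    pow x c * (pow x d * pow x d)      ≈⟨ *-congˡ (pow-square x d) ⟨
    pow x c * pow (pow x 2) d          ∎

  *-zeroʳ-both : ∀ {a b c d} → b ≈ 0# → d ≈ 0# → a * b ≈ c * d
  *-zeroʳ-both {a} {b} {c} {d} b≈0 d≈0 = begin
    a * b   ≈⟨ *-congˡ b≈0 ⟩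
    a * 0#  ≈⟨ zeroʳ a ⟩
    0#      ≈⟨ zeroʳ c ⟨
    c * 0#  ≈⟨ *-congˡ d≈0 ⟨
    c * d   ∎

  ≈-by-difference : ∀ {x y} k a b → x ≈ y + k * (a - b) → a ≈ b → x ≈ y
  ≈-by-difference {x} {y} k a b x≈y+k[a-b] a≈b = begin
    x                ≈⟨ x≈y+k[a-b] ⟩
    y + k * (a - b)  ≈⟨ +-congˡ (*-congˡ (+-congʳ a≈b)) ⟩
    y + k * (b - b)  ≈⟨ solve 3 (λ y k b → y :+ k :* (b :- b) := y) refl y k b ⟩
    y                ∎

  x^a*x^[i′²]≈x^[i²]*[x²]^d : ∀ x a (i′ i : ℤ) d →
                              + a ℤ.+ i′ ℤ.* i′ ≡ i ℤ.* i ℤ.+ (+ d ℤ.+ + d) →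
                     pow x a * pow x (square i′) ≈ pow x (square i) * pow (pow x 2) d
  x^a*x^[i′²]≈x^[i²]*[x²]^d x a i′ i d eq = x^a*x^b≈x^c*[x²]^d x a (square i′) (square i) d 
    (ℤₚ.+-injective (≡.trans (≡.cong (λ w → + a ℤ.+ w) (+∣i∣²≡i*i i′))
                     (≡.trans eq (≡.cong (λ w → w ℤ.+ (+ d ℤ.+ + d)) (≡.sym (+∣i∣²≡i*i i))))))

  sumTo-cong : ∀ {f g : ℕ → Carrier} n → (∀ r → f r ≈ g r) → sumTo f n ≈ sumTo g n
  sumTo-cong zero    f≈g = f≈g 0
  sumTo-cong (suc n) f≈g = +-cong (sumTo-cong n f≈g) (f≈g (suc n))

  sumTo-+ : ∀ (f g : ℕ → Carrier) n → sumTo (λ r → f r + g r) n ≈ sumTo f n + sumTo g n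
  sumTo-+ f g zero    = refl
  sumTo-+ f g (suc n) = trans (+-congʳ (sumTo-+ f g n))
    (solve 4 (λ a b c d → (a :+ b) :+ (c :+ d) := (a :+ c) :+ (b :+ d)) refl
      (sumTo f n) (sumTo g n) (f (suc n)) (g (suc n)))

  sumTo-*ˡ : ∀ a (f : ℕ → Carrier) n → sumTo (λ r → a * f r) n ≈ a * sumTo f n
  sumTo-*ˡ a f zero    = refl
  sumTo-*ˡ a f (suc n) = trans (+-congʳ (sumTo-*ˡ a f n)) (sym (distribˡ a _ _))

  sumTo-suc : ∀ (f : ℕ → Carrier) n → sumTo f (suc n) ≈ f 0 + sumTo (λ r → f (suc r)) n
  sumTo-suc f zero    = refl
  sumTo-suc f (suc n) = trans (+-congʳ (sumTo-suc f n)) (+-assoc _ _ _)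

  sumTo-extend : ∀ (f : ℕ → Carrier) n → f (suc n) ≈ 0# → sumTo f (suc n) ≈ sumTo f n
  sumTo-extend f n f[1+n]≈0 = trans (+-congˡ f[1+n]≈0) (+-identityʳ _)

  sumTo-shift : ∀ (f : ℕ → Carrier) n → f 0 ≈ 0# → sumTo f (suc n) ≈ sumTo (λ r → f (suc r)) n
  sumTo-shift f n f0≈0 = trans (sumTo-suc f n) (trans (+-congʳ f0≈0) (+-identityˡ _))

  SolvesRecurrence : (α β : ℕ → Carrier) → (ℕ → ℤ → Carrier) → Set ℓ
  SolvesRecurrence α β f = ∀ n j → f (suc n) j ≈ α n * f n j + β n * (f n (ℤ.pred j) + f n (ℤ.suc j))

  recurrence-unique : ∀ {α β f g} → SolvesRecurrence α β f → SolvesRecurrence α β g →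
                      (∀ j → f 0 j ≈ g 0 j) → ∀ n j → f n j ≈ g n j
  recurrence-unique                 f-rec g-rec f₀≈g₀ zero    j = f₀≈g₀ j
  recurrence-unique {α} {β} {f} {g} f-rec g-rec f₀≈g₀ (suc n) j = begin
    f (suc n) j                                          ≈⟨ f-rec n j ⟩
    α n * f n j + β n * (f n (ℤ.pred j) + f n (ℤ.suc j))
      ≈⟨ +-cong (*-congˡ (fₙ≈gₙ j)) (*-congˡ (+-cong (fₙ≈gₙ _) (fₙ≈gₙ _))) ⟩
    α n * g n j + β n * (g n (ℤ.pred j) + g n (ℤ.suc j)) ≈⟨ g-rec n j ⟨
    g (suc n) j                                          ∎
    where fₙ≈gₙ = recurrence-unique f-rec g-rec f₀≈g₀ n

  ifSameParity-*ˡ : ∀ r j a b → ifSameParity r j (a * b) ≈ a * ifSameParity r j b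
  ifSameParity-*ˡ r j a b with ∣ + r ℤ.- j ∣ ℕ.% 2 ℕₚ.≟ 0
  ... | yes _ = refl
  ... | no _  = sym (zeroʳ a)

  module GaussianBinomial (x : Carrier) where

    qbinℕ-vanish : ∀ n k → n < k → qbinℕ x n k ≈ 0#
    qbinℕ-vanish zero    (suc k) _         = refl
    qbinℕ-vanish (suc n) (suc k) (s≤s n<k) = begin
      qbinℕ x n k + pow x (suc k) * qbinℕ x n (suc k)
        ≈⟨ +-cong (qbinℕ-vanish n k n<k) (*-congˡ (qbinℕ-vanish n (suc k) (ℕₚ.m<n⇒m<1+n n<k))) ⟩
      0# + pow x (suc k) * 0#   ≈⟨ solve 1 (λ y → 0ₚ :+ y :* 0ₚ := 0ₚ) refl (pow x (suc k)) ⟩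
      0#                        ∎

    qbinℕ-diag : ∀ n → qbinℕ x n n ≈ 1#
    qbinℕ-diag zero    = refl
    qbinℕ-diag (suc n) = begin
      qbinℕ x n n + pow x (suc n) * qbinℕ x n (suc n)
        ≈⟨ +-cong (qbinℕ-diag n) (*-congˡ (qbinℕ-vanish n (suc n) ℕₚ.≤-refl)) ⟩
      1# + pow x (suc n) * 0#   ≈⟨ solve 1 (λ y → 1ₚ :+ y :* 0ₚ := 1ₚ) refl (pow x (suc n)) ⟩
      1#                        ∎

    qbinℕ-index : ∀ {m n} k → m ≡ n → qbinℕ x m k ≈ qbinℕ x n k
    qbinℕ-index k m≡n = reflexive (≡.cong (λ m → qbinℕ x m k) m≡n)

    binom : ℕ → ℕ → Carrier
    binom a b = qbinℕ x (a ℕ.+ b) a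

    binom-suc : ∀ a b → binom (suc a) b ≈ qbinℕ x (a ℕ.+ suc b) (suc a)
    binom-suc a b = qbinℕ-index (suc a) (≡.sym (ℕₚ.+-suc a b))

    binom-pascal : ∀ a b → binom (suc a) (suc b) ≈ binom a (suc b) + pow x (suc a) * binom (suc a) b
    binom-pascal a b = +-congˡ (*-congˡ (sym (binom-suc a b)))

    binom-zeroʳ : ∀ a → binom a 0 ≈ 1#
    binom-zeroʳ a = trans (qbinℕ-index a (ℕₚ.+-identityʳ a)) (qbinℕ-diag a)

    binom-absorbʳ : ∀ a b → (1# - pow x (suc a)) * binom (suc a) b ≈ (1# - pow x (suc b)) * binom a (suc b)
    binom-absorbʳ zero zero =
      solve 1 (λ x → (1ₚ :- x :* 1ₚ) :* (1ₚ :+ (x :* 1ₚ) :* 0ₚ) := (1ₚ :- x :* 1ₚ) :* 1ₚ) refl x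
    binom-absorbʳ zero (suc b) = begin
      (1# - x * 1#) * binom 1 (suc b)         ≈⟨ *-congˡ (binom-pascal 0 b) ⟩
      (1# - x * 1#) * (1# + (x * 1#) * B)     ≈⟨ solve 2 (λ x B → (1ₚ :- x :* 1ₚ) :* (1ₚ :+ (x :* 1ₚ) :* B)
                                                   := (1ₚ :- x :* 1ₚ) :+ x :* ((1ₚ :- x :* 1ₚ) :* B)) refl x B ⟩
      (1# - x * 1#) + x * ((1# - x * 1#) * B) ≈⟨ +-congˡ (*-congˡ (binom-absorbʳ zero b)) ⟩
      (1# - x * 1#) + x * ((1# - p) * 1#)     ≈⟨ solve 2 (λ x p → (1ₚ :- x :* 1ₚ) :+ x :* ((1ₚ :- p) :* 1ₚ)
                                                   := (1ₚ :- x :* p) :* 1ₚ) refl x p ⟩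
      (1# - x * p) * 1#                       ∎
      where B = binom 1 b; p = pow x (suc b)
    binom-absorbʳ (suc a) zero = begin
      (1# - x * p) * binom (suc (suc a)) 0    ≈⟨ *-congˡ (binom-zeroʳ (suc (suc a))) ⟩
      (1# - x * p) * 1#                       ≈⟨ solve 2 (λ x p → (1ₚ :- x :* p) :* 1ₚ
                                                   := (1ₚ :- p) :* 1ₚ :+ (1ₚ :- x :* 1ₚ) :* (p :* 1ₚ)) refl x p ⟩
      (1# - p) * 1# + (1# - x * 1#) * (p * 1#)
        ≈⟨ +-cong (*-congˡ (binom-zeroʳ (suc a))) (*-congˡ (*-congˡ (binom-zeroʳ (suc a)))) ⟨
      (1# - p) * binom (suc a) 0 + (1# - x * 1#) * (p * binom (suc a) 0)
        ≈⟨ +-congʳ (binom-absorbʳ a zero) ⟩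
      (1# - x * 1#) * binom a 1 + (1# - x * 1#) * (p * binom (suc a) 0) ≈⟨ distribˡ _ _ _ ⟨
      (1# - x * 1#) * (binom a 1 + p * binom (suc a) 0)                   ≈⟨ *-congˡ (binom-pascal a 0) ⟨
      (1# - x * 1#) * binom (suc a) 1 ∎
      where p = pow x (suc a)
    binom-absorbʳ (suc a) (suc b) = begin
      (1# - x * p) * binom (suc (suc a)) (suc b)    ≈⟨ *-congˡ (binom-pascal (suc a) b) ⟩
      (1# - x * p) * (U + x * p * V)
        ≈⟨ solve 4 (λ x p U V → (1ₚ :- x :* p) :* (U :+ x :* p :* V)
                             := (1ₚ :- x :* p) :* U :+ x :* p :* ((1ₚ :- x :* p) :* V)) refl x p U V ⟩
      (1# - x * p) * U + x * p * ((1# - x * p) * V) ≈⟨ +-congˡ (*-congˡ (binom-absorbʳ (suc a) b)) ⟩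
      (1# - x * p) * U + x * p * ((1# - r) * U)
        ≈⟨ solve 4 (λ x p r U → (1ₚ :- x :* p) :* U :+ x :* p :* ((1ₚ :- r) :* U)
                             := (1ₚ :- p) :* U :+ p :* ((1ₚ :- x :* r) :* U)) refl x p r U ⟩
      (1# - p) * U + p * ((1# - x * r) * U)         ≈⟨ +-congʳ (binom-absorbʳ a (suc b)) ⟩
      (1# - x * r) * W + p * ((1# - x * r) * U)
        ≈⟨ solve 5 (λ x p r U W → (1ₚ :- x :* r) :* W :+ p :* ((1ₚ :- x :* r) :* U)
                               := (1ₚ :- x :* r) :* (W :+ p :* U)) refl x p r U W ⟩
      (1# - x * r) * (W + p * U)                    ≈⟨ *-congˡ (binom-pascal a (suc b)) ⟨
      (1# - x * r) * binom (suc a) (suc (suc b))    ∎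
      where p = pow x (suc a); r = pow x (suc b)
            U = binom (suc a) (suc b); V = binom (suc (suc a)) b; W = binom a (suc (suc b))

    binom-absorbˡ : ∀ a b → (1# - pow x (suc a)) * binom (suc a) b ≈ (1# - pow x (suc (a ℕ.+ b))) * binom a b
    binom-absorbˡ a zero = *-cong (+-congˡ (-‿cong (pow-cong x (≡.cong suc (≡.sym (ℕₚ.+-identityʳ a))))))
                                  (trans (binom-zeroʳ (suc a)) (sym (binom-zeroʳ a)))
    binom-absorbˡ a (suc b) = begin
      (1# - p) * binom (suc a) (suc b)      ≈⟨ *-congˡ (binom-pascal a b) ⟩
      (1# - p) * (W + p * V)                ≈⟨ solve 3 (λ p W V → (1ₚ :- p) :* (W :+ p :* V)
                                               := (1ₚ :- p) :* W :+ p :* ((1ₚ :- p) :* V)) refl p W V ⟩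
      (1# - p) * W + p * ((1# - p) * V)     ≈⟨ +-congˡ (*-congˡ (binom-absorbʳ a b)) ⟩
      (1# - p) * W + p * ((1# - r) * W)     ≈⟨ solve 3 (λ p r W → (1ₚ :- p) :* W :+ p :* ((1ₚ :- r) :* W)
                                               := (1ₚ :- p :* r) :* W) refl p r W ⟩
      (1# - p * r) * W                      ≈⟨ *-congʳ (+-congˡ (-‿cong (pow-+ x (suc a) (suc b)))) ⟨
      (1# - pow x (suc a ℕ.+ suc b)) * W    ∎
      where p = pow x (suc a); r = pow x (suc b); V = binom (suc a) b; W = binom a (suc b)

    binom-pascal₂ : ∀ a b → binom (suc a) (suc b) ≈ pow x (suc b) * binom a (suc b) + binom (suc a) b
    binom-pascal₂ a b = trans (binom-pascal a b) (≈-by-difference 1# _ _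
      (solve 4 (λ p r W V → W :+ p :* V := r :* W :+ V :+ 1ₚ :* ((1ₚ :- r) :* W :- (1ₚ :- p) :* V)) refl p r W V)
      (sym (binom-absorbʳ a b)))
      where p = pow x (suc a); r = pow x (suc b); V = binom (suc a) b; W = binom a (suc b)

    qbinPred : ℕ → ℕ → Carrier
    qbinPred n zero    = 0#
    qbinPred n (suc k) = qbinℕ x n k

    qbinℕ-pascal : ∀ n k → qbinℕ x (suc n) k ≈ qbinPred n k + pow x k * qbinℕ x n k
    qbinℕ-pascal n zero    = solve 0 (1ₚ := 0ₚ :+ 1ₚ :* 1ₚ) refl
    qbinℕ-pascal n (suc k) = refl

    qbinℕ-pascal₂ : ∀ a b → qbinℕ x (suc (a ℕ.+ b)) (suc a) ≈
                            pow x b * qbinℕ x (a ℕ.+ b) a + qbinℕ x (a ℕ.+ b) (suc a)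
    qbinℕ-pascal₂ a zero rewrite ℕₚ.+-identityʳ a = begin
      qbinℕ x (suc a) (suc a)                   ≈⟨ qbinℕ-diag (suc a) ⟩
      1#                                        ≈⟨ solve 0 (1ₚ := 1ₚ :* 1ₚ :+ 0ₚ) refl ⟩
      1# * 1# + 0#
        ≈⟨ +-cong (*-congˡ (qbinℕ-diag a)) (qbinℕ-vanish a (suc a) ℕₚ.≤-refl) ⟨
      1# * qbinℕ x a a + qbinℕ x a (suc a)      ∎
    qbinℕ-pascal₂ a (suc b) = trans (binom-pascal₂ a b) (+-congˡ (binom-suc a b))

    qbinℕ-pascal₂-pred : ∀ a b → qbinℕ x (suc (a ℕ.+ b)) a ≈
                                 pow x (suc b) * qbinPred (a ℕ.+ b) a + qbinℕ x (a ℕ.+ b) a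
    qbinℕ-pascal₂-pred zero    b = solve 1 (λ p → 1ₚ := p :* 0ₚ :+ 1ₚ) refl (pow x (suc b))
    qbinℕ-pascal₂-pred (suc a) b = begin
      qbinℕ x (suc (suc (a ℕ.+ b))) (suc a)     ≈⟨ qbinℕ-index (suc a) (≡.cong suc +-suc′) ⟩
      qbinℕ x (suc (a ℕ.+ suc b)) (suc a)       ≈⟨ qbinℕ-pascal₂ a (suc b) ⟩
      pow x (suc b) * qbinℕ x (a ℕ.+ suc b) a + qbinℕ x (a ℕ.+ suc b) (suc a)
        ≈⟨ +-cong (*-congˡ (qbinℕ-index a (ℕₚ.+-suc a b))) (qbinℕ-index (suc a) (ℕₚ.+-suc a b)) ⟩
      pow x (suc b) * qbinℕ x (suc (a ℕ.+ b)) a + qbinℕ x (suc (a ℕ.+ b)) (suc a) ∎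
      where +-suc′ = ≡.sym (ℕₚ.+-suc a b)

    qbinℕ-absorbʳ : ∀ k b → (1# - pow x (suc k)) * qbinℕ x (k ℕ.+ b) (suc k) ≈
                            (1# - pow x b) * qbinℕ x (k ℕ.+ b) k
    qbinℕ-absorbʳ k zero = begin
      (1# - pow x (suc k)) * qbinℕ x (k ℕ.+ 0) (suc k) ≈⟨ *-congˡ (qbinℕ-vanish (k ℕ.+ 0) (suc k) k+0<1+k) ⟩
      (1# - pow x (suc k)) * 0#
        ≈⟨ solve 2 (λ p B → (1ₚ :- p) :* 0ₚ := (1ₚ :- 1ₚ) :* B) refl _ _ ⟩
      (1# - 1#) * qbinℕ x (k ℕ.+ 0) k                  ∎
      where k+0<1+k = s≤s (ℕₚ.≤-reflexive (ℕₚ.+-identityʳ k))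
    qbinℕ-absorbʳ k (suc b) = trans (*-congˡ (sym (binom-suc k b))) (binom-absorbʳ k b)

    qbinℕ-absorbʳ-pred : ∀ r s → (1# - pow x r) * qbinℕ x (r ℕ.+ s) r ≈
                                 (1# - pow x (suc s)) * qbinPred (r ℕ.+ s) r
    qbinℕ-absorbʳ-pred zero    s = solve 1 (λ p → (1ₚ :- 1ₚ) :* 1ₚ := (1ₚ :- p) :* 0ₚ) refl (pow x (suc s))
    qbinℕ-absorbʳ-pred (suc r) s = trans (binom-absorbʳ r s) (*-congˡ (qbinℕ-index r (ℕₚ.+-suc r s)))

    qbinℕ-absorbˡ : ∀ n k → (1# - pow x (suc k)) * qbinℕ x (suc n) (suc k) ≈ (1# - pow x (suc n)) * qbinℕ x n k
    qbinℕ-absorbˡ n k with position n k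
    ... | inside k b   = binom-absorbˡ k b
    ... | justAbove n  = *-zeroʳ-both (qbinℕ-vanish (suc n) (suc (suc n)) ℕₚ.≤-refl)
                                      (qbinℕ-vanish n (suc n) ℕₚ.≤-refl)
    ... | farAbove n u = *-zeroʳ-both (qbinℕ-vanish (suc n) _ (s≤s n<2+n+u)) (qbinℕ-vanish n _ n<2+n+u)
      where n<2+n+u = s≤s (ℕₚ.m≤n⇒m≤1+n (ℕₚ.m≤m+n n u))

    qbinℕ-three-term : ∀ a b → qbinℕ x (suc (suc (a ℕ.+ b))) (suc a) ≈
      (1# + pow x (suc (a ℕ.+ b))) * qbinℕ x (a ℕ.+ b) a + pow x (suc a) * qbinℕ x (a ℕ.+ b) (suc a)
        + pow x (suc b) * qbinPred (a ℕ.+ b) a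
    qbinℕ-three-term a b = begin
      qbinℕ x (suc (a ℕ.+ b)) a + p * qbinℕ x (suc (a ℕ.+ b)) (suc a)
        ≈⟨ +-cong (qbinℕ-pascal₂-pred a b) (*-congˡ (qbinℕ-pascal₂ a b)) ⟩
      (r * L + B) + p * (pow x b * B + C)
        ≈⟨ solve 6 (λ r L B p y C → (r :* L :+ B) :+ p :* (y :* B :+ C) := (1ₚ :+ p :* y) :* B :+ p :* C :+ r :* L)
             refl r L B p (pow x b) C ⟩
      (1# + p * pow x b) * B + p * C + r * L
        ≈⟨ +-congʳ (+-congʳ (*-congʳ (+-congˡ (pow-+ x (suc a) b)))) ⟨
      (1# + pow x (suc (a ℕ.+ b))) * B + p * C + r * L ∎
      where p = pow x (suc a); r = pow x (suc b)
            B = qbinℕ x (a ℕ.+ b) a; C = qbinℕ x (a ℕ.+ b) (suc a); L = qbinPred (a ℕ.+ b) a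

    -- qbinHalf r k m = [r, k + m/2]_x for even m and 0 for odd m;
    -- qbinHalfℤ r d = [r, d/2]_x for even d ≥ 0 and 0 otherwise.
    qbinHalf : ℕ → ℕ → ℕ → Carrier
    qbinHalf r k zero          = qbinℕ x r k
    qbinHalf r k (suc zero)    = 0#
    qbinHalf r k (suc (suc m)) = qbinHalf r (suc k) m

    qbinHalf-recurrence : ∀ r k m → qbinHalf r (suc k) m + qbinHalf r k m ≈
                                    qbinHalf (suc r) (suc k) m + (1# - pow x r) * qbinHalf (r ∸ 1) k m
    qbinHalf-recurrence zero    k zero =
      solve 2 (λ p B → 0ₚ :+ B := (B :+ p :* 0ₚ) :+ (1ₚ :- 1ₚ) :* B) refl (pow x (suc k)) (qbinℕ x 0 k)
    qbinHalf-recurrence (suc r) k zero = ≈-by-difference 1# _ _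
      (solve 5 (λ p q A B C → A :+ B
                           := (B :+ p :* A) :+ (1ₚ :- q) :* C :+ 1ₚ :* ((1ₚ :- p) :* A :- (1ₚ :- q) :* C))
         refl (pow x (suc k)) (pow x (suc r)) (qbinℕ x (suc r) (suc k)) (qbinℕ x (suc r) k) (qbinℕ x r k))
      (qbinℕ-absorbˡ r k)
    qbinHalf-recurrence r k (suc zero)    = solve 1 (λ a → 0ₚ :+ 0ₚ := 0ₚ :+ a :* 0ₚ) refl (1# - pow x r)
    qbinHalf-recurrence r k (suc (suc m)) = qbinHalf-recurrence r (suc k) m

    qbinHalf-even : ∀ r k m → m ℕ.% 2 ≡ 0 → qbinHalf r k m ≈ qbinℕ x r (k ℕ.+ m ℕ./ 2)
    qbinHalf-even r k zero          _ = reflexive (≡.cong (qbinℕ x r) (≡.sym (ℕₚ.+-identityʳ k)))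
    qbinHalf-even r k (suc (suc m)) m%2≡0 = trans (qbinHalf-even r (suc k) m m%2≡0)
      (reflexive (≡.cong (qbinℕ x r) (≡.trans (≡.sym (ℕₚ.+-suc k (m ℕ./ 2)))
                                              (≡.cong (k ℕ.+_) (≡.sym [2+m]/2≡1+m/2)))))
      where [2+m]/2≡1+m/2 = ℕDM.m/n≡1+[m∸n]/n {suc (suc m)} {2} (s≤s (s≤s z≤n))

    qbinHalf-odd : ∀ r k m → m ℕ.% 2 ≢ 0 → qbinHalf r k m ≈ 0#
    qbinHalf-odd r k zero          m%2≢0 = ⊥-elim (m%2≢0 ≡.refl)
    qbinHalf-odd r k (suc zero)    _     = refl
    qbinHalf-odd r k (suc (suc m)) m%2≢0 = qbinHalf-odd r (suc k) m m%2≢0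

    qbinHalf-zero : ∀ k m → qbinHalf 0 (suc k) m ≈ 0#
    qbinHalf-zero k zero          = refl
    qbinHalf-zero k (suc zero)    = refl
    qbinHalf-zero k (suc (suc m)) = qbinHalf-zero (suc k) m

    qbinHalfℤ : ℕ → ℤ → Carrier
    qbinHalfℤ r (+ m)    = qbinHalf r 0 m
    qbinHalfℤ r -[1+ _ ] = 0#

    qbinHalfℤ-recurrence : ∀ r d → qbinHalfℤ r (ℤ.suc d) + qbinHalfℤ r (ℤ.pred d) ≈
                                   qbinHalfℤ (suc r) (ℤ.suc d) + (1# - pow x r) * qbinHalfℤ (r ∸ 1) (ℤ.pred d)
    qbinHalfℤ-recurrence r (+ zero)     = qbinHalf-recurrence r 0 1
    qbinHalfℤ-recurrence r (+ suc m)    = qbinHalf-recurrence r 0 m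
    qbinHalfℤ-recurrence r -[1+ zero ]  = solve 1 (λ a → 1ₚ :+ 0ₚ := 1ₚ :+ a :* 0ₚ) refl (1# - pow x r)
    qbinHalfℤ-recurrence r -[1+ suc m ] = solve 1 (λ a → 0ₚ :+ 0ₚ := 0ₚ :+ a :* 0ₚ) refl (1# - pow x r)

    qbin-half-even : ∀ r d → ∣ d ∣ ℕ.% 2 ≡ 0 → qbin x (+ r) (d ℤ./ + 2) ≈ qbinHalfℤ r d
    qbin-half-even r (+ m) m%2≡0 = trans (reflexive (≡.cong (qbin x (+ r)) (ℤₚ.*-identityˡ (+ (m ℕ./ 2)))))
                                    (sym (qbinHalf-even r 0 m m%2≡0))
    qbin-half-even r -[1+ zero ] ()
    qbin-half-even r -[1+ suc m ] m%2≡0 with m ℕ.% 2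
    ... | zero  = reflexive (≡.cong (λ k → qbin x (+ r) (+ 1 ℤ.* ℤ.- (+ k)))
                                    (ℕDM.m/n≡1+[m∸n]/n {suc (suc m)} {2} (s≤s (s≤s z≤n))))
    ... | suc _ = refl

    ifSameParity-qbin : ∀ r j → ifSameParity r j (qbin x (+ r) ((+ r ℤ.- j) ℤ./ + 2)) ≈ qbinHalfℤ r (+ r ℤ.- j)
    ifSameParity-qbin r j with ∣ + r ℤ.- j ∣ ℕ.% 2 ℕₚ.≟ 0
    ... | yes even = qbin-half-even r (+ r ℤ.- j) even
    ... | no odd   = sym (qbinHalfℤ-odd (+ r ℤ.- j) odd)
      where
      qbinHalfℤ-odd : ∀ d → ∣ d ∣ ℕ.% 2 ≢ 0 → qbinHalfℤ r d ≈ 0#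
      qbinHalfℤ-odd (+ m)    = qbinHalf-odd r 0 m
      qbinHalfℤ-odd -[1+ _ ] _ = refl


  module Sides (t : Carrier) where
    q Q : Carrier
    q = pow t 2
    Q = pow q 2

    module Gq = GaussianBinomial q
    module GQ = GaussianBinomial Q

    selfWeight neighbourWeight : ℕ → Carrier
    selfWeight n      = 1# + pow q (suc (n ℕ.+ n))
    neighbourWeight n = pow t (suc (n ℕ.+ n))

    poch-index : ∀ {m n} → m ≡ n → poch (- q) q m ≈ poch (- q) q n
    poch-index m≡n = reflexive (≡.cong (poch (- q) q) m≡n)

    poch-pred : ∀ s → poch (- q) q (ℕ.pred s) * (1# - pow Q s) ≈ poch (- q) q s * (1# - pow q s)
    poch-pred zero    = refl
    poch-pred (suc s) = begin
      P * (1# - Q * pow Q s)            ≈⟨ *-congˡ (+-congˡ (-‿cong (*-congˡ (pow-square q s)))) ⟩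
      P * (1# - q * (q * 1#) * (v * v)) ≈⟨ solve 3 (λ P q v → P :* (1ₚ :- q :* (q :* 1ₚ) :* (v :* v))
                                           := P :* (1ₚ :- :- q :* v) :* (1ₚ :- q :* v)) refl P q v ⟩
      P * (1# - - q * v) * (1# - q * v) ∎
      where P = poch (- q) q s; v = pow q s

    coeff : ℕ → ℕ → Carrier
    coeff n r = pow t (r ℕ.* r) * poch (- q) q (n ∸ r) * qbinℕ Q n r

    coeffPred : ℕ → ℕ → Carrier
    coeffPred n zero    = 0#
    coeffPred n (suc r) = coeff n r

    coeff-vanish : ∀ n r → n < r → coeff n r ≈ 0#
    coeff-vanish n r n<r = trans (*-congˡ (GQ.qbinℕ-vanish n r n<r)) (zeroʳ _)

    -- The recurrence for coeff at n = r + s, read with T = t^(r²), P = (−q;q)_s, L = [r+s, r−1]_Q,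
    -- B = [r+s, r]_Q, u = q^r, v = q^s; the hypothesis is the absorption identity in that notation.
    coeff-recurrence-identity : ∀ T P L B u v → (1# - u * u) * B ≈ (1# - q * (q * 1#) * (v * v)) * L →
      T * (P * (1# - - q * v)) * (L + u * u * B) ≈
      (1# + q * (u * v * (u * v))) * (T * P * B)
        + (T * (q * v) * (P * (1# - - q * v)) * L + T * (u * (u * (q * v))) * (P * (1# - v)) * B)
    coeff-recurrence-identity T P L B u v absorb = ≈-by-difference (T * P) _ _
      (solve 7 (λ q T P L B u v →
          T :* (P :* (1ₚ :- :- q :* v)) :* (L :+ u :* u :* B)
        := (1ₚ :+ q :* (u :* v :* (u :* v))) :* (T :* P :* B)
             :+ (T :* (q :* v) :* (P :* (1ₚ :- :- q :* v)) :* L :+ T :* (u :* (u :* (q :* v))) :* (P :* (1ₚ :- v)) :* B)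
             :+ T :* P :* ((1ₚ :- q :* (q :* 1ₚ) :* (v :* v)) :* L :- (1ₚ :- u :* u) :* B))
        refl q T P L B u v)
      (sym absorb)

    module _ (r s : ℕ) where
      private
        T = pow t (r ℕ.* r)
        P = poch (- q) q s
        u = pow q r
        v = pow q s
        B = qbinℕ Q (r ℕ.+ s) r
        L = GQ.qbinPred (r ℕ.+ s) r

      suc[r+s]∸r≡suc[s] : suc (r ℕ.+ s) ∸ r ≡ suc s
      suc[r+s]∸r≡suc[s] = ≡.trans (ℕₚ.+-∸-assoc 1 (ℕₚ.m≤m+n r s)) (≡.cong suc (ℕₚ.m+n∸m≡n r s))

      coeff-inside : coeff (r ℕ.+ s) r ≈ T * P * B
      coeff-inside = *-congʳ (*-congˡ (poch-index (ℕₚ.m+n∸m≡n r s)))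

      coeff-suc-inside : coeff (suc (r ℕ.+ s)) r ≈ T * (P * (1# - - q * v)) * (L + u * u * B)
      coeff-suc-inside = *-cong (*-congˡ (poch-index suc[r+s]∸r≡suc[s]))
                                (trans (GQ.qbinℕ-pascal (r ℕ.+ s) r) (+-congˡ (*-congʳ (pow-square q r))))

      selfWeight-inside : selfWeight (r ℕ.+ s) ≈ 1# + q * (u * v * (u * v))
      selfWeight-inside = +-congˡ (*-congˡ (trans (pow-+ q (r ℕ.+ s) (r ℕ.+ s)) (*-cong uv uv)))
        where uv = pow-+ q r s

      neighbour-coeff-suc-inside : neighbourWeight (r ℕ.+ s) * ((1# - pow Q (suc r)) * coeff (r ℕ.+ s) (suc r)) ≈
                                   T * (u * (u * (q * v))) * (P * (1# - v)) * B
      neighbour-coeff-suc-inside = begin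
        neighbourWeight (r ℕ.+ s) * ((1# - pow Q (suc r)) * (T₁ * P₁ * X))
          ≈⟨ solve 5 (λ k a T P X → k :* (a :* (T :* P :* X)) := k :* T :* (P :* (a :* X))) refl
               (neighbourWeight (r ℕ.+ s)) (1# - pow Q (suc r)) T₁ P₁ X ⟩
        neighbourWeight (r ℕ.+ s) * T₁ * (P₁ * ((1# - pow Q (suc r)) * X))
          ≈⟨ *-cong (x^a*x^b≈x^c*[x²]^d t (suc ((r ℕ.+ s) ℕ.+ (r ℕ.+ s))) (suc r ℕ.* suc r) (r ℕ.* r)
                                            (r ℕ.+ (r ℕ.+ suc s)) (exponents r s))
                    (*-congˡ (GQ.qbinℕ-absorbʳ r s)) ⟩
        T * pow q (r ℕ.+ (r ℕ.+ suc s)) * (P₁ * ((1# - pow Q s) * B))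
          ≈⟨ *-cong (*-congˡ (trans (pow-+ q r _) (*-congˡ (pow-+ q r (suc s))))) (sym (*-assoc P₁ _ B)) ⟩
        T * (u * (u * (q * v))) * (P₁ * (1# - pow Q s) * B)
          ≈⟨ *-congˡ (*-congʳ (trans (*-congʳ (poch-index [r+s]∸[1+r]≡pred[s])) (poch-pred s))) ⟩
        T * (u * (u * (q * v))) * (P * (1# - v) * B)
          ≈⟨ *-assoc _ _ B ⟨
        T * (u * (u * (q * v))) * (P * (1# - v)) * B ∎
        where
        T₁ = pow t (suc r ℕ.* suc r)
        P₁ = poch (- q) q ((r ℕ.+ s) ∸ suc r)
        X  = qbinℕ Q (r ℕ.+ s) (suc r)
        [r+s]∸[1+r]≡pred[s] : (r ℕ.+ s) ∸ suc r ≡ ℕ.pred s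
        [r+s]∸[1+r]≡pred[s] = ≡.trans (≡.sym (ℕₚ.pred[m∸n]≡m∸[1+n] (r ℕ.+ s) r))
                                      (≡.cong ℕ.pred (ℕₚ.m+n∸m≡n r s))
        exponents : ∀ r s → suc ((r ℕ.+ s) ℕ.+ (r ℕ.+ s)) ℕ.+ suc r ℕ.* suc r ≡
                            r ℕ.* r ℕ.+ ((r ℕ.+ (r ℕ.+ suc s)) ℕ.+ (r ℕ.+ (r ℕ.+ suc s)))
        exponents = solve-∀

      absorb-inside : (1# - u * u) * B ≈ (1# - q * (q * 1#) * (v * v)) * L
      absorb-inside = begin
        (1# - u * u) * B                     ≈⟨ *-congʳ (+-congˡ (-‿cong (pow-square q r))) ⟨
        (1# - pow Q r) * B                   ≈⟨ GQ.qbinℕ-absorbʳ-pred r s ⟩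
        (1# - Q * pow Q s) * L               ≈⟨ *-congʳ (+-congˡ (-‿cong (*-congˡ (pow-square q s)))) ⟩
        (1# - q * (q * 1#) * (v * v)) * L    ∎

    neighbour-coeffPred-inside : ∀ r s → neighbourWeight (r ℕ.+ s) * coeffPred (r ℕ.+ s) r ≈
      pow t (r ℕ.* r) * (q * pow q s) * (poch (- q) q s * (1# - - q * pow q s)) * GQ.qbinPred (r ℕ.+ s) r
    neighbour-coeffPred-inside zero    s = *-zeroʳ-both refl refl
    neighbour-coeffPred-inside (suc r) s = begin
      neighbourWeight (suc r ℕ.+ s) * (pow t (r ℕ.* r) * poch (- q) q (suc (r ℕ.+ s) ∸ r) * X)
        ≈⟨ *-congˡ (*-congʳ (*-congˡ (poch-index (suc[r+s]∸r≡suc[s] r s)))) ⟩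
      neighbourWeight (suc r ℕ.+ s) * (pow t (r ℕ.* r) * P′ * X)
        ≈⟨ solve 4 (λ k a P X → k :* (a :* P :* X) := k :* a :* P :* X) refl _ _ P′ X ⟩
      neighbourWeight (suc r ℕ.+ s) * pow t (r ℕ.* r) * P′ * X
        ≈⟨ *-congʳ (*-congʳ (x^a*x^b≈x^c*[x²]^d t (suc ((suc r ℕ.+ s) ℕ.+ (suc r ℕ.+ s))) (r ℕ.* r)
                                                  (suc r ℕ.* suc r) (suc s) (exponents r s))) ⟩
      pow t (suc r ℕ.* suc r) * (q * pow q s) * P′ * X ∎
      where
      P′ = poch (- q) q (suc s)
      X  = qbinℕ Q (suc (r ℕ.+ s)) r
      exponents : ∀ r s → suc ((suc r ℕ.+ s) ℕ.+ (suc r ℕ.+ s)) ℕ.+ r ℕ.* r ≡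
                          suc r ℕ.* suc r ℕ.+ (suc s ℕ.+ suc s)
      exponents = solve-∀

    coeff-diag : ∀ n → coeff n n ≈ pow t (n ℕ.* n)
    coeff-diag n = begin
      pow t (n ℕ.* n) * poch (- q) q (n ∸ n) * qbinℕ Q n n
        ≈⟨ *-cong (*-congˡ (poch-index (ℕₚ.n∸n≡0 n))) (GQ.qbinℕ-diag n) ⟩
      pow t (n ℕ.* n) * 1# * 1#                            ≈⟨ trans (*-identityʳ _) (*-identityʳ _) ⟩
      pow t (n ℕ.* n)                                      ∎

    coeff-recurrence : ∀ n r → coeff (suc n) r ≈
      selfWeight n * coeff n r + neighbourWeight n * (coeffPred n r + (1# - pow Q (suc r)) * coeff n (suc r))
    coeff-recurrence n r with position n r
    ... | inside r s = begin
      coeff (suc (r ℕ.+ s)) r                       ≈⟨ coeff-suc-inside r s ⟩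
      T * (P * (1# - - q * v)) * (L + u * u * B)    ≈⟨ coeff-recurrence-identity T P L B u v (absorb-inside r s) ⟩
      (1# + q * (u * v * (u * v))) * (T * P * B)
        + (T * (q * v) * (P * (1# - - q * v)) * L + T * (u * (u * (q * v))) * (P * (1# - v)) * B)
        ≈⟨ +-cong (*-cong (selfWeight-inside r s) (coeff-inside r s))
                  (trans (distribˡ _ _ _) (+-cong (neighbour-coeffPred-inside r s) (neighbour-coeff-suc-inside r s))) ⟨
      selfWeight (r ℕ.+ s) * coeff (r ℕ.+ s) r
        + neighbourWeight (r ℕ.+ s) * (coeffPred (r ℕ.+ s) r + (1# - pow Q (suc r)) * coeff (r ℕ.+ s) (suc r)) ∎
      where
      T = pow t (r ℕ.* r); P = poch (- q) q s; u = pow q r; v = pow q s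
      B = qbinℕ Q (r ℕ.+ s) r; L = GQ.qbinPred (r ℕ.+ s) r
    ... | justAbove n = begin
      coeff (suc n) (suc n)                     ≈⟨ coeff-diag (suc n) ⟩
      pow t (suc n ℕ.* suc n)
        ≈⟨ trans (pow-cong t (exponent n)) (pow-+ t (suc (n ℕ.+ n)) (n ℕ.* n)) ⟩
      neighbourWeight n * pow t (n ℕ.* n)
        ≈⟨ solve 4 (λ a k T b → k :* T := a :* 0ₚ :+ k :* (T :+ b :* 0ₚ)) refl
             (selfWeight n) (neighbourWeight n) (pow t (n ℕ.* n)) (1# - pow Q (suc (suc n))) ⟩
      selfWeight n * 0# + neighbourWeight n * (pow t (n ℕ.* n) + (1# - pow Q (suc (suc n))) * 0#)
        ≈⟨ +-cong (*-congˡ (coeff-vanish n (suc n) ℕₚ.≤-refl))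
                  (*-congˡ (+-cong (coeff-diag n)
                                   (*-congˡ (coeff-vanish n (suc (suc n)) (ℕₚ.m<n⇒m<1+n ℕₚ.≤-refl))))) ⟨
      selfWeight n * coeff n (suc n)
        + neighbourWeight n * (coeff n n + (1# - pow Q (suc (suc n))) * coeff n (suc (suc n))) ∎
      where
      exponent : ∀ n → suc n ℕ.* suc n ≡ suc (n ℕ.+ n) ℕ.+ n ℕ.* n
      exponent = solve-∀
    ... | farAbove n u = begin
      coeff (suc n) r     ≈⟨ coeff-vanish (suc n) r (s≤s n<r) ⟩
      0#                  ≈⟨ solve 3 (λ a k b → 0ₚ := a :* 0ₚ :+ k :* (0ₚ :+ b :* 0ₚ)) refl _ _ _ ⟩
      selfWeight n * 0# + neighbourWeight n * (0# + (1# - pow Q (suc r)) * 0#)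
        ≈⟨ +-cong (*-congˡ (coeff-vanish n r (ℕₚ.m<n⇒m<1+n n<r)))
                  (*-congˡ (+-cong (coeff-vanish n _ n<r)
                                   (*-congˡ (coeff-vanish n (suc r) (ℕₚ.m<n⇒m<1+n (ℕₚ.m<n⇒m<1+n n<r)))))) ⟨
      selfWeight n * coeff n r + neighbourWeight n * (coeffPred n r + (1# - pow Q (suc r)) * coeff n (suc r)) ∎
      where
      n<r : n < suc (n ℕ.+ u)
      n<r = s≤s (ℕₚ.m≤m+n n u)

    coeff-sum-recurrence : ∀ n (g : ℕ → Carrier) →
      sumTo (λ r → coeff (suc n) r * g r) (suc n) ≈
      selfWeight n * sumTo (λ r → coeff n r * g r) n
        + neighbourWeight n * sumTo (λ r → coeff n r * (g (suc r) + (1# - pow Q r) * g (r ∸ 1))) n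
    coeff-sum-recurrence n g = begin
      sumTo (λ r → coeff (suc n) r * g r) (suc n)
        ≈⟨ sumTo-cong (suc n) (λ r → trans (*-congʳ (coeff-recurrence n r)) (expand r)) ⟩
      sumTo (λ r → selfWeight n * (coeff n r * g r) + neighbourWeight n * (coeffPred n r * g r + F (suc r))) (suc n)
        ≈⟨ trans (sumTo-+ _ _ (suc n))
                 (+-cong (sumTo-*ˡ _ _ (suc n)) (trans (sumTo-*ˡ _ _ (suc n)) (*-congˡ (sumTo-+ _ _ (suc n))))) ⟩
      selfWeight n * sumTo (λ r → coeff n r * g r) (suc n)
        + neighbourWeight n * (sumTo (λ r → coeffPred n r * g r) (suc n) + sumTo (λ r → F (suc r)) (suc n))
        ≈⟨ +-cong (*-congˡ (sumTo-extend _ n (vanishing (ℕₚ.n<1+n n))))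
                  (*-congˡ (+-cong (sumTo-shift _ n (zeroˡ _)) shiftF)) ⟩
      selfWeight n * sumTo (λ r → coeff n r * g r) n
        + neighbourWeight n * (sumTo (λ r → coeff n r * g (suc r)) n + sumTo F n)
        ≈⟨ +-congˡ (*-congˡ (trans (sumTo-cong n distribute) (sumTo-+ _ _ n))) ⟨
      selfWeight n * sumTo (λ r → coeff n r * g r) n
        + neighbourWeight n * sumTo (λ r → coeff n r * (g (suc r) + (1# - pow Q r) * g (r ∸ 1))) n ∎
      where
      F : ℕ → Carrier
      F r = (1# - pow Q r) * coeff n r * g (r ∸ 1)

      vanishing : ∀ {r} → n < r → coeff n r * g r ≈ 0#
      vanishing n<r = trans (*-congʳ (coeff-vanish n _ n<r)) (zeroˡ _)

      expand : ∀ r →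
        (selfWeight n * coeff n r + neighbourWeight n * (coeffPred n r + (1# - pow Q (suc r)) * coeff n (suc r))) * g r
          ≈ selfWeight n * (coeff n r * g r) + neighbourWeight n * (coeffPred n r * g r + F (suc r))
      expand r = solve 7 (λ a k x y z w h → (a :* x :+ k :* (y :+ z :* w)) :* h
                                         := a :* (x :* h) :+ k :* (y :* h :+ z :* w :* h))
        refl (selfWeight n) (neighbourWeight n) (coeff n r) (coeffPred n r) (1# - pow Q (suc r)) (coeff n (suc r)) (g r)

      shiftF : sumTo (λ r → F (suc r)) (suc n) ≈ sumTo F n
      shiftF = begin
        sumTo (λ r → F (suc r)) (suc n) ≈⟨ sumTo-shift F (suc n) F0≈0 ⟨
        sumTo F (suc (suc n))           ≈⟨ sumTo-extend F (suc n) (Fvanish (ℕₚ.m<n⇒m<1+n (ℕₚ.n<1+n n))) ⟩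
        sumTo F (suc n)                 ≈⟨ sumTo-extend F n (Fvanish (ℕₚ.n<1+n n)) ⟩
        sumTo F n                       ∎
        where
        F0≈0 : F 0 ≈ 0#
        F0≈0 = solve 2 (λ c h → (1ₚ :- 1ₚ) :* c :* h := 0ₚ) refl (coeff n 0) (g 0)
        Fvanish : ∀ {r} → n < r → F r ≈ 0#
        Fvanish n<r = trans (*-congʳ (trans (*-congˡ (coeff-vanish n _ n<r)) (zeroʳ _))) (zeroˡ _)

      distribute : ∀ r → coeff n r * (g (suc r) + (1# - pow Q r) * g (r ∸ 1)) ≈ coeff n r * g (suc r) + F r
      distribute r = solve 4 (λ c x a y → c :* (x :+ a :* y) := c :* x :+ a :* c :* y) refl
        (coeff n r) (g (suc r)) (1# - pow Q r) (g (r ∸ 1))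

    parityTerm : ℕ → ℤ → Carrier
    parityTerm r j = GQ.qbinHalfℤ r (+ r ℤ.- j)

    parityTerm-recurrence : ∀ r j → parityTerm (suc r) j + (1# - pow Q r) * parityTerm (r ∸ 1) j ≈
                                    parityTerm r (ℤ.pred j) + parityTerm r (ℤ.suc j)
    parityTerm-recurrence r j = begin
      parityTerm (suc r) j + (1# - pow Q r) * parityTerm (r ∸ 1) j
        ≈⟨ +-cong (index (suc r) (suc[i]-j≡suc[i-j] (+ r) j)) (lower r) ⟩
      GQ.qbinHalfℤ (suc r) (ℤ.suc d) + (1# - pow Q r) * GQ.qbinHalfℤ (r ∸ 1) (ℤ.pred d)
        ≈⟨ GQ.qbinHalfℤ-recurrence r d ⟨
      GQ.qbinHalfℤ r (ℤ.suc d) + GQ.qbinHalfℤ r (ℤ.pred d)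
        ≈⟨ +-cong (index r (i-pred[j]≡suc[i-j] (+ r) j)) (index r (i-suc[j]≡pred[i-j] (+ r) j)) ⟨
      parityTerm r (ℤ.pred j) + parityTerm r (ℤ.suc j) ∎
      where
      d = + r ℤ.- j
      index : ∀ r {d d′} → d ≡ d′ → GQ.qbinHalfℤ r d ≈ GQ.qbinHalfℤ r d′
      index r d≡d′ = reflexive (≡.cong (GQ.qbinHalfℤ r) d≡d′)
      lower : ∀ r → (1# - pow Q r) * parityTerm (r ∸ 1) j ≈
                    (1# - pow Q r) * GQ.qbinHalfℤ (r ∸ 1) (ℤ.pred (+ r ℤ.- j))
      lower zero    = solve 2 (λ A B → (1ₚ :- 1ₚ) :* A := (1ₚ :- 1ₚ) :* B) refl _ _
      lower (suc r) = *-congˡ (index r (≡.trans (≡.sym (ℤₚ.pred-suc (+ r ℤ.- j)))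
                                                (≡.cong ℤ.pred (≡.sym (suc[i]-j≡suc[i-j] (+ r) j)))))

    lhsSum : ℕ → ℤ → Carrier
    lhsSum n j = sumTo (λ r → coeff n r * parityTerm r j) n

    lhsSum-recurrence : SolvesRecurrence selfWeight neighbourWeight lhsSum
    lhsSum-recurrence n j = begin
      lhsSum (suc n) j
        ≈⟨ coeff-sum-recurrence n (λ r → parityTerm r j) ⟩
      selfWeight n * lhsSum n j
        + neighbourWeight n * sumTo (λ r → coeff n r * (parityTerm (suc r) j + (1# - pow Q r) * parityTerm (r ∸ 1) j)) n
        ≈⟨ +-congˡ (*-congˡ (sumTo-cong n (λ r → trans (*-congˡ (parityTerm-recurrence r j)) (distribˡ _ _ _)))) ⟩
      selfWeight n * lhsSum n j
        + neighbourWeight n * sumTo (λ r → coeff n r * parityTerm r (ℤ.pred j) + coeff n r * parityTerm r (ℤ.suc j)) n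
        ≈⟨ +-congˡ (*-congˡ (sumTo-+ _ _ n)) ⟩
      selfWeight n * lhsSum n j + neighbourWeight n * (lhsSum n (ℤ.pred j) + lhsSum n (ℤ.suc j)) ∎

    rhsTerm : ℕ → ℤ → Carrier
    rhsTerm n k = pow t (square (+ n ℤ.- k)) * qbin q (+ (n ℕ.+ n)) k

    neighbour-rhsTerm-suc : ∀ n a → neighbourWeight n * pow t (square (+ n ℤ.- + suc a)) ≈
                                    pow t (square (+ n ℤ.- + a)) * pow q (suc a)
    neighbour-rhsTerm-suc n a =
      x^a*x^[i′²]≈x^[i²]*[x²]^d t (suc (n ℕ.+ n)) (+ n ℤ.- + suc a) (+ n ℤ.- + a) (suc a)
                                (exponents (+ n) (+ a))
      where
      exponents : ∀ n a → (+ 1 ℤ.+ (n ℤ.+ n)) ℤ.+ (n ℤ.- (+ 1 ℤ.+ a)) ℤ.* (n ℤ.- (+ 1 ℤ.+ a)) ≡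
                          (n ℤ.- a) ℤ.* (n ℤ.- a) ℤ.+ ((+ 1 ℤ.+ a) ℤ.+ (+ 1 ℤ.+ a))
      exponents = ℤ-Solver.solve-∀

    neighbour-rhsTerm-pred : ∀ n a b → n ℕ.+ n ≡ a ℕ.+ b → neighbourWeight n * rhsTerm n (ℤ.pred (+ a)) ≈
                             pow t (square (+ n ℤ.- + a)) * (pow q (suc b) * Gq.qbinPred (a ℕ.+ b) a)
    neighbour-rhsTerm-pred n zero    b _  = solve 4 (λ k x y r → k :* (x :* 0ₚ) := y :* (r :* 0ₚ)) refl _ _ _ _
    neighbour-rhsTerm-pred n (suc a) b eq = begin
      neighbourWeight n * (pow t (square (+ n ℤ.- + a)) * qbinℕ q (n ℕ.+ n) a)
        ≈⟨ *-assoc _ _ _ ⟨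
      neighbourWeight n * pow t (square (+ n ℤ.- + a)) * qbinℕ q (n ℕ.+ n) a
        ≈⟨ *-cong (x^a*x^[i′²]≈x^[i²]*[x²]^d t (suc (n ℕ.+ n)) (+ n ℤ.- + a) (+ n ℤ.- + suc a) (suc b) exponents)
                  (Gq.qbinℕ-index a eq) ⟩
      pow t (square (+ n ℤ.- + suc a)) * pow q (suc b) * qbinℕ q (suc a ℕ.+ b) a
        ≈⟨ *-assoc _ _ _ ⟩
      pow t (square (+ n ℤ.- + suc a)) * (pow q (suc b) * qbinℕ q (suc a ℕ.+ b) a) ∎
      where
      exponents : + suc (n ℕ.+ n) ℤ.+ (+ n ℤ.- + a) ℤ.* (+ n ℤ.- + a) ≡
                  (+ n ℤ.- + suc a) ℤ.* (+ n ℤ.- + suc a) ℤ.+ (+ suc b ℤ.+ + suc b)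
      exponents = ≡.trans (up-to-2[2n-a-b-1] (+ n) (+ a) (+ b))
        (≡.trans (≡.cong (λ m → X ℤ.+ (δ m ℤ.+ δ m)) eq)
                 (≡.trans (≡.cong (λ w → X ℤ.+ (w ℤ.+ w)) (ℤₚ.+-inverseʳ (+ (suc a ℕ.+ b))))
                          (ℤₚ.+-identityʳ X)))
        where
        X = (+ n ℤ.- + suc a) ℤ.* (+ n ℤ.- + suc a) ℤ.+ (+ suc b ℤ.+ + suc b)
        δ : ℕ → ℤ
        δ m = + m ℤ.- + (suc a ℕ.+ b)
        up-to-2[2n-a-b-1] : ∀ n a b → (+ 1 ℤ.+ (n ℤ.+ n)) ℤ.+ (n ℤ.- a) ℤ.* (n ℤ.- a) ≡
          (n ℤ.- (+ 1 ℤ.+ a)) ℤ.* (n ℤ.- (+ 1 ℤ.+ a)) ℤ.+ ((+ 1 ℤ.+ b) ℤ.+ (+ 1 ℤ.+ b))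
            ℤ.+ (((n ℤ.+ n) ℤ.- ((+ 1 ℤ.+ a) ℤ.+ b)) ℤ.+ ((n ℤ.+ n) ℤ.- ((+ 1 ℤ.+ a) ℤ.+ b)))
        up-to-2[2n-a-b-1] = ℤ-Solver.solve-∀

    private
      rhsTerm-recurrence-+ : ∀ n a {N} → n ℕ.+ n ≡ N → Position N a → rhsTerm (suc n) (+ suc a) ≈
        selfWeight n * rhsTerm n (+ a) + neighbourWeight n * (rhsTerm n (+ suc a) + rhsTerm n (ℤ.pred (+ a)))
      rhsTerm-recurrence-+ n a eq (inside .a b) = begin
        pow t (square (+ suc n ℤ.- + suc a)) * qbinℕ q (suc n ℕ.+ suc n) (suc a)
          ≈⟨ *-cong (pow-cong t (≡.cong square ([1+n]-[1+k]≡n-k (+ n) (+ a))))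
                    (Gq.qbinℕ-index (suc a) 2n+2≡a+b+2) ⟩
        T * qbinℕ q (suc (suc (a ℕ.+ b))) (suc a)
          ≈⟨ *-congˡ (Gq.qbinℕ-three-term a b) ⟩
        T * ((1# + pow q (suc (a ℕ.+ b))) * B + p * C + r * L)
          ≈⟨ solve 7 (λ T K B p C r L → T :* (K :* B :+ p :* C :+ r :* L)
                                       := K :* (T :* B) :+ (T :* p :* C :+ T :* (r :* L)))
               refl T (1# + pow q (suc (a ℕ.+ b))) B p C r L ⟩
        (1# + pow q (suc (a ℕ.+ b))) * (T * B) + (T * p * C + T * (r * L))
          ≈⟨ +-cong (*-cong (+-congˡ (pow-cong q (≡.cong suc eq))) (*-congˡ (Gq.qbinℕ-index a eq)))
                    (trans (distribˡ _ _ _)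
                           (+-cong (trans (sym (*-assoc _ _ _))
                                          (*-cong (neighbour-rhsTerm-suc n a) (Gq.qbinℕ-index (suc a) eq)))
                                   (neighbour-rhsTerm-pred n a b eq))) ⟨
        selfWeight n * rhsTerm n (+ a) + neighbourWeight n * (rhsTerm n (+ suc a) + rhsTerm n (ℤ.pred (+ a))) ∎
        where
        T = pow t (square (+ n ℤ.- + a)); p = pow q (suc a); r = pow q (suc b)
        B = qbinℕ q (a ℕ.+ b) a; C = qbinℕ q (a ℕ.+ b) (suc a); L = Gq.qbinPred (a ℕ.+ b) a
        2n+2≡a+b+2 : suc n ℕ.+ suc n ≡ suc (suc (a ℕ.+ b))
        2n+2≡a+b+2 = ≡.cong suc (≡.trans (ℕₚ.+-suc n n) (≡.cong suc eq))
        [1+n]-[1+k]≡n-k : ∀ n k → (+ 1 ℤ.+ n) ℤ.- (+ 1 ℤ.+ k) ≡ n ℤ.- k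
        [1+n]-[1+k]≡n-k = ℤ-Solver.solve-∀
      rhsTerm-recurrence-+ n _ ≡.refl (justAbove _) = begin
        pow t (square (+ suc n ℤ.- + suc N₊)) * qbinℕ q (suc n ℕ.+ suc n) (suc N₊)
          ≈⟨ *-congˡ (trans (Gq.qbinℕ-index (suc N₊) (≡.cong suc (ℕₚ.+-suc n n))) (Gq.qbinℕ-diag (suc N₊))) ⟩
        pow t (square (+ suc n ℤ.- + suc N₊)) * 1#
          ≈⟨ x^a*x^[i′²]≈x^[i²]*[x²]^d t (suc N) (+ n ℤ.- + N) (+ suc n ℤ.- + suc N₊) 0 (exponents (+ n)) ⟨
        neighbourWeight n * T
          ≈⟨ solve 5 (λ a k x y T → k :* T := a :* (x :* 0ₚ) :+ k :* (y :* 0ₚ :+ T :* 1ₚ)) refl _ _ _ _ T ⟩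
        selfWeight n * (pow t (square (+ n ℤ.- + N₊)) * 0#)
          + neighbourWeight n * (pow t (square (+ n ℤ.- + suc N₊)) * 0# + T * 1#)
          ≈⟨ +-cong (*-congˡ (*-congˡ (Gq.qbinℕ-vanish N N₊ ℕₚ.≤-refl)))
                    (*-congˡ (+-cong (*-congˡ (Gq.qbinℕ-vanish N (suc N₊) (ℕₚ.m<n⇒m<1+n ℕₚ.≤-refl)))
                                     (*-congˡ (Gq.qbinℕ-diag N)))) ⟨
        selfWeight n * rhsTerm n (+ N₊) + neighbourWeight n * (rhsTerm n (+ suc N₊) + rhsTerm n (+ N)) ∎
        where
        N = n ℕ.+ n
        N₊ = suc N
        T = pow t (square (+ n ℤ.- + N))
        exponents : ∀ n → (+ 1 ℤ.+ (n ℤ.+ n)) ℤ.+ (n ℤ.- (n ℤ.+ n)) ℤ.* (n ℤ.- (n ℤ.+ n)) ≡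
          ((+ 1 ℤ.+ n) ℤ.- (+ 1 ℤ.+ (+ 1 ℤ.+ (n ℤ.+ n)))) ℤ.* ((+ 1 ℤ.+ n) ℤ.- (+ 1 ℤ.+ (+ 1 ℤ.+ (n ℤ.+ n))))
            ℤ.+ (+ 0 ℤ.+ + 0)
        exponents = ℤ-Solver.solve-∀
      rhsTerm-recurrence-+ n _ ≡.refl (farAbove _ u) = begin
        pow t (square (+ suc n ℤ.- + suc a)) * qbinℕ q (suc n ℕ.+ suc n) (suc a)
          ≈⟨ *-congˡ (trans (Gq.qbinℕ-index (suc a) (≡.cong suc (ℕₚ.+-suc n n)))
                            (Gq.qbinℕ-vanish (suc (suc N)) (suc a) (s≤s (s≤s N<a)))) ⟩
        pow t (square (+ suc n ℤ.- + suc a)) * 0#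
          ≈⟨ solve 6 (λ x α y k z w → x :* 0ₚ := α :* (y :* 0ₚ) :+ k :* (z :* 0ₚ :+ w :* 0ₚ)) refl _ _ _ _ _ _ ⟩
        selfWeight n * (pow t (square (+ n ℤ.- + a)) * 0#)
          + neighbourWeight n * (pow t (square (+ n ℤ.- + suc a)) * 0# + pow t (square (+ n ℤ.- + suc (N ℕ.+ u))) * 0#)
          ≈⟨ +-cong (*-congˡ (*-congˡ (Gq.qbinℕ-vanish N a (ℕₚ.m<n⇒m<1+n N<a))))
                    (*-congˡ (+-cong (*-congˡ (Gq.qbinℕ-vanish N (suc a) (ℕₚ.m<n⇒m<1+n (ℕₚ.m<n⇒m<1+n N<a))))
                                     (*-congˡ (Gq.qbinℕ-vanish N _ N<a)))) ⟨
        selfWeight n * rhsTerm n (+ a) + neighbourWeight n * (rhsTerm n (+ suc a) + rhsTerm n (+ suc (N ℕ.+ u))) ∎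
        where
        N = n ℕ.+ n
        a = suc (suc (N ℕ.+ u))
        N<a : N < suc (N ℕ.+ u)
        N<a = s≤s (ℕₚ.m≤m+n N u)

    rhsTerm-recurrence : ∀ n k → rhsTerm (suc n) (ℤ.suc k) ≈
      selfWeight n * rhsTerm n k + neighbourWeight n * (rhsTerm n (ℤ.suc k) + rhsTerm n (ℤ.pred k))
    rhsTerm-recurrence n (+ a)          = rhsTerm-recurrence-+ n a ≡.refl (position (n ℕ.+ n) a)
    rhsTerm-recurrence n -[1+ zero ]    = begin
      pow t (square (+ suc n ℤ.- + 0)) * 1#
        ≈⟨ x^a*x^[i′²]≈x^[i²]*[x²]^d t (suc (n ℕ.+ n)) (+ n ℤ.- + 0) (+ suc n ℤ.- + 0) 0 (exponents (+ n)) ⟨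
      neighbourWeight n * T
        ≈⟨ solve 5 (λ a k x y T → k :* T := a :* (x :* 0ₚ) :+ k :* (T :* 1ₚ :+ y :* 0ₚ)) refl _ _ _ _ T ⟩
      selfWeight n * rhsTerm n -[1+ 0 ] + neighbourWeight n * (T * 1# + rhsTerm n -[1+ 1 ]) ∎
      where
      T = pow t (square (+ n ℤ.- + 0))
      exponents : ∀ n → (+ 1 ℤ.+ (n ℤ.+ n)) ℤ.+ (n ℤ.- + 0) ℤ.* (n ℤ.- + 0) ≡
                        ((+ 1 ℤ.+ n) ℤ.- + 0) ℤ.* ((+ 1 ℤ.+ n) ℤ.- + 0) ℤ.+ (+ 0 ℤ.+ + 0)
      exponents = ℤ-Solver.solve-∀
    rhsTerm-recurrence n -[1+ suc u ]   =
      solve 6 (λ x α y k z w → x :* 0ₚ := α :* (y :* 0ₚ) :+ k :* (z :* 0ₚ :+ w :* 0ₚ)) refl _ _ _ _ _ _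

    rhsReindexed : ℕ → ℤ → Carrier
    rhsReindexed n j = rhsTerm n (+ n ℤ.- j)

    rhsReindexed-recurrence : SolvesRecurrence selfWeight neighbourWeight rhsReindexed
    rhsReindexed-recurrence n j = begin
      rhsTerm (suc n) (+ suc n ℤ.- j)
        ≈⟨ index (suc[i]-j≡suc[i-j] (+ n) j) ⟩
      rhsTerm (suc n) (ℤ.suc k)
        ≈⟨ rhsTerm-recurrence n k ⟩
      selfWeight n * rhsTerm n k + neighbourWeight n * (rhsTerm n (ℤ.suc k) + rhsTerm n (ℤ.pred k))
        ≈⟨ +-congˡ (*-congˡ (+-cong (index (i-pred[j]≡suc[i-j] (+ n) j)) (index (i-suc[j]≡pred[i-j] (+ n) j)))) ⟨
      selfWeight n * rhsReindexed n j + neighbourWeight n * (rhsReindexed n (ℤ.pred j) + rhsReindexed n (ℤ.suc j)) ∎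
      where
      k = + n ℤ.- j
      index : ∀ {m k k′} → k ≡ k′ → rhsTerm m k ≈ rhsTerm m k′
      index k≡k′ = reflexive (≡.cong (rhsTerm _) k≡k′)

    lhsSum≈rhsReindexed-base : ∀ j → lhsSum 0 j ≈ rhsReindexed 0 j
    lhsSum≈rhsReindexed-base j = base (+ 0 ℤ.- j)
      where
      base : ∀ d → 1# * 1# * 1# * GQ.qbinHalfℤ 0 d ≈ pow t (square (+ 0 ℤ.- d)) * qbin q (+ 0) d
      base (+ zero)          = solve 0 (1ₚ :* 1ₚ :* 1ₚ :* 1ₚ := 1ₚ :* 1ₚ) refl
      base (+ suc zero)      = *-zeroʳ-both refl refl
      base (+ suc (suc m))   = *-zeroʳ-both (GQ.qbinHalf-zero 0 m) refl
      base -[1+ _ ]          = *-zeroʳ-both refl refl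

    lhs≈lhsSum : ∀ n j → lhs t (+ n) j ≈ lhsSum n j
    lhs≈lhsSum n j =
      sumTo-cong n (λ r → trans (ifSameParity-*ˡ r j (coeff n r) _) (*-congˡ (GQ.ifSameParity-qbin r j)))

    rhsReindexed≈rhs : ∀ n j → rhsReindexed n j ≈ rhs t (+ n) j
    rhsReindexed≈rhs n j = *-cong (pow-cong t (≡.cong square (n-[n-j]≡j (+ n) j)))
                                  (reflexive (≡.cong (λ N → qbin q N (+ n ℤ.- j)) (≡.sym 2*n≡n+n)))
      where
      n-[n-j]≡j : ∀ n j → n ℤ.- (n ℤ.- j) ≡ j
      n-[n-j]≡j = ℤ-Solver.solve-∀
      2*n≡n+n : + 2 ℤ.* + n ≡ + (n ℕ.+ n)
      2*n≡n+n = ≡.trans (ℤₚ.+◃n≡+n (2 ℕ.* n)) (≡.cong (λ m → + (n ℕ.+ m)) (ℕₚ.+-identityʳ n))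

lemma2p1 : {c ℓ : Level} (R : CommutativeRing c ℓ) (t : CommutativeRing.Carrier R) (L j : ℤ) →
    CommutativeRing._≈_ R (QSeries.lhs R t L j) (QSeries.rhs R t L j)
lemma2p1 R t (+ n) j = begin
  lhs t (+ n) j     ≈⟨ lhs≈lhsSum n j ⟩
  lhsSum n j        ≈⟨ recurrence-unique lhsSum-recurrence rhsReindexed-recurrence lhsSum≈rhsReindexed-base n j ⟩
  rhsReindexed n j  ≈⟨ rhsReindexed≈rhs n j ⟩
  rhs t (+ n) j     ∎
  where
  open CommutativeRing R using (setoid)
  open QSeries R using (lhs; rhs)
  open Properties R
  open Sides t
  open import Relation.Binary.Reasoning.Setoid setoid
lemma2p1 R t -[1+ n ] j = sym (zeroʳ _)
  where open CommutativeRing R
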